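{- For integers $n \geq 0$ and $k \geq 1$ define \[ c_{n, k} = \frac{2}{4^{k}}\sum_{j = 1}^{k}(-1)^{k - j}\binom{2k}{k - j}(2j)^{2n}. \] Then for all integers $n \geq k \geq 1$, \[ \sum_{i = k}^{n}\binom{k}{i - k}c_{n, i} = 2^{2(n - k)}c_{n, k}. \]
   Context: Convention: $\binom{n}{k} = 0$ whenever $k < 0$ or $n < k$. (These $c_{n,k}$ are the coefficients in $\frac{d^{2n}}{dx^{2n}}\coth(x) = \sum_{k=1}^n c_{n,k}\frac{\cosh(x)}{\sinh(x)^{2k+1}}$; they satisfy $c_{n,k}=0$ for $k>n$ and $c_{n,n}=(2n)!$.) -}

module Defs where

open import Data.Nat as ℕ using (ℕ; zero; suc; _∸_)
open import Data.Nat.Combinatorics using (_C_)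
open import Data.Nat.Properties using (m^n≢0)
open import Data.Integer as ℤ using (ℤ; +_)
open import Data.Rational as ℚ using (ℚ; _/_; _+_; _*_; -_; 0ℚ; 1ℚ)

-- ∑[ i ∈ a .. b ] f i  :=  f a + f (a+1) + ... + f b  (empty, i.e. 0, if b < a)
-- sumRange a m f = f a + ... + f (a + m - 1)   (m terms)
sumRange : ℕ → ℕ → (ℕ → ℚ) → ℚ
sumRange a zero    f = 0ℚ
sumRange a (suc m) f = f a + sumRange (suc a) m f

sumFromTo : ℕ → ℕ → (ℕ → ℚ) → ℚ
sumFromTo a b f = sumRange a (suc b ∸ a) f

ℕ→ℚ : ℕ → ℚ
ℕ→ℚ m = (+ m) / 1

sign : ℕ → ℚ
sign zero    = 1ℚ
sign (suc m) = - sign m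

c : ℕ → ℕ → ℚ
c n k = ((+ 2) / (4 ℕ.^ k)) {{m^n≢0 4 k}}
        * sumFromTo 1 k (λ j → sign (k ∸ j) * ℕ→ℚ (((2 ℕ.* k) C (k ∸ j)) ℕ.* ((2 ℕ.* j) ℕ.^ (2 ℕ.* n))))

module Submission where

-- Let p = (y ↦ y^(2n)) and consider the following operators on functions f : ℚ → ℚ:
--   δ f x = f (x+1) − f (x−1),   μ f x = ½ (f (x+1) + f (x−1)),   δ₂ f x = f (x+2) − f (x−2).
-- (1) Central difference formula: for n ≥ 1, c n i = ¼^i (δ^(2i) p)(0).  Indeed
--     (δ^r f)(x) = Σ_m (−1)^m C(r,m) f(x + r − 2m), and for r = 2i, x = 0 and p even the
--     terms m and 2i − m coincide while the middle term is p(0) = 0.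
-- (2) Operator identities: μ² = 1 + ¼ δ² and μ δ = ½ δ₂ (all operators commute).  Hence
--     μ^(2k) = Σ_m C(k,m) ¼^m δ^(2m)   and   μ^(2k) δ^(2k) = ¼^k δ₂^(2k).
-- (3) Dilation: (δ₂^r f)(2x) = δ^r (y ↦ f(2y)) (x), and p(2y) = 4^n p(y).
-- (4) δ^r annihilates y^e for e < r (Leibniz rule), so c n i = 0 for i > n.
-- Then, writing n = k + d,
--   Σ_{i=k}^{n} C(k,i−k) c n i = Σ_{m≤k} C(k,m) ¼^(k+m) (δ^(2m) δ^(2k) p)(0)      by (1), (4)
--                              = ¼^k (μ^(2k) δ^(2k) p)(0) = ¼^(2k) 4^n (δ^(2k) p)(0) by (2), (3)
--                              = 4^d c n k                                          by (1).

open import Defs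
open import Data.Nat as ℕ using (ℕ; zero; suc; _≤_; _<_; _∸_; s≤s)
import Data.Nat.Properties as NP
import Data.Nat.Tactic.RingSolver as ℕ-Solver
open import Data.Nat.Combinatorics using (_C_; nCk+nC[k+1]≡[n+1]C[k+1]; nCk≡nC[n∸k])
open import Data.Nat.Combinatorics.Specification using (k>n⇒nCk≡0)
open import Data.Nat.GeneralisedArithmetic using (iterate)
open import Data.Integer as ℤ using (+_)
import Data.Integer.Properties as ZP
import Data.Integer.Tactic.RingSolver as ℤ-Solver
open import Data.Rational as ℚ using (ℚ; _+_; _*_; -_; _-_; 0ℚ; 1ℚ; ½; _/_)
import Data.Rational.Properties as QP
import Data.Rational.Unnormalised as U
import Data.Rational.Unnormalised.Properties as UP
open import Algebra.Bundles using (CommutativeRing)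
open import Algebra.Properties.CommutativeSemiring.Exp
  (CommutativeRing.commutativeSemiring QP.+-*-commutativeRing) using (_^_; ^-homo-*; ^-distrib-*; ^-assocʳ)
open import Data.Sum using (_⊎_; inj₁; inj₂)
open import Relation.Binary.PropositionalEquality
open import Relation.Nullary.Decidable using (dec⇒maybe)
open import Tactic.RingSolver using (solve-∀)
open import Tactic.RingSolver.Core.AlmostCommutativeRing using (AlmostCommutativeRing; fromCommutativeRing)

ℚ-ring : AlmostCommutativeRing _ _
ℚ-ring = fromCommutativeRing QP.+-*-commutativeRing (λ x → dec⇒maybe (0ℚ QP.≟ x))

-- ℕ→ℚ is a semiring homomorphism, checked on the unnormalised rationals where m ↦ m/1 is literal.
toℚᵘ-ℕ→ℚ : ∀ m → ℚ.toℚᵘ (ℕ→ℚ m) U.≃ U.mkℚᵘ (+ m) 0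
toℚᵘ-ℕ→ℚ m = QP.toℚᵘ-fromℚᵘ (U.mkℚᵘ (+ m) 0)

ℕ→ℚ-+ : ∀ a b → ℕ→ℚ (a ℕ.+ b) ≡ ℕ→ℚ a + ℕ→ℚ b
ℕ→ℚ-+ a b = QP.toℚᵘ-injective (begin
  ℚ.toℚᵘ (ℕ→ℚ (a ℕ.+ b))              ≈⟨ toℚᵘ-ℕ→ℚ (a ℕ.+ b) ⟩
  U.mkℚᵘ (+ (a ℕ.+ b)) 0              ≈⟨ U.*≡* (cong (ℤ._* + 1) (trans (ZP.pos-+ a b) (unit (+ a) (+ b)))) ⟩
  U.mkℚᵘ (+ a) 0 U.+ U.mkℚᵘ (+ b) 0   ≈⟨ UP.+-cong (toℚᵘ-ℕ→ℚ a) (toℚᵘ-ℕ→ℚ b) ⟨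
  ℚ.toℚᵘ (ℕ→ℚ a) U.+ ℚ.toℚᵘ (ℕ→ℚ b)   ≈⟨ QP.toℚᵘ-homo-+ (ℕ→ℚ a) (ℕ→ℚ b) ⟨
  ℚ.toℚᵘ (ℕ→ℚ a + ℕ→ℚ b)              ∎)
  where
  open UP.≃-Reasoning
  unit : ∀ x y → x ℤ.+ y ≡ x ℤ.* + 1 ℤ.+ y ℤ.* + 1
  unit = ℤ-Solver.solve-∀

ℕ→ℚ-* : ∀ a b → ℕ→ℚ (a ℕ.* b) ≡ ℕ→ℚ a * ℕ→ℚ b
ℕ→ℚ-* a b = QP.toℚᵘ-injective (begin
  ℚ.toℚᵘ (ℕ→ℚ (a ℕ.* b))              ≈⟨ toℚᵘ-ℕ→ℚ (a ℕ.* b) ⟩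
  U.mkℚᵘ (+ (a ℕ.* b)) 0              ≈⟨ UP.≃-reflexive (cong (λ z → U.mkℚᵘ z 0) (ZP.pos-* a b)) ⟩
  U.mkℚᵘ (+ a) 0 U.* U.mkℚᵘ (+ b) 0   ≈⟨ UP.*-cong (toℚᵘ-ℕ→ℚ a) (toℚᵘ-ℕ→ℚ b) ⟨
  ℚ.toℚᵘ (ℕ→ℚ a) U.* ℚ.toℚᵘ (ℕ→ℚ b)   ≈⟨ QP.toℚᵘ-homo-* (ℕ→ℚ a) (ℕ→ℚ b) ⟨
  ℚ.toℚᵘ (ℕ→ℚ a * ℕ→ℚ b)              ∎)
  where open UP.≃-Reasoning

ℕ→ℚ-suc : ∀ m → ℕ→ℚ (suc m) ≡ 1ℚ + ℕ→ℚ m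
ℕ→ℚ-suc m = ℕ→ℚ-+ 1 m

ℕ→ℚ-^ : ∀ a e → ℕ→ℚ (a ℕ.^ e) ≡ ℕ→ℚ a ^ e
ℕ→ℚ-^ a zero    = refl
ℕ→ℚ-^ a (suc e) = trans (ℕ→ℚ-* a (a ℕ.^ e)) (cong (ℕ→ℚ a *_) (ℕ→ℚ-^ a e))

ℕ→ℚ-2* : ∀ a → ℕ→ℚ (2 ℕ.* a) ≡ ℕ→ℚ a + ℕ→ℚ a
ℕ→ℚ-2* a = trans (cong ℕ→ℚ (cong (a ℕ.+_) (NP.+-identityʳ a))) (ℕ→ℚ-+ a a)

/-cancel : ∀ a N .{{_ : ℕ.NonZero N}} → ((+ a) / N) * ℕ→ℚ N ≡ ℕ→ℚ a
/-cancel a N@(suc d) = QP.toℚᵘ-injective (begin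
  ℚ.toℚᵘ ((+ a / N) * ℕ→ℚ N)                 ≈⟨ QP.toℚᵘ-homo-* (+ a / N) (ℕ→ℚ N) ⟩
  ℚ.toℚᵘ (+ a / N) U.* ℚ.toℚᵘ (ℕ→ℚ N)        ≈⟨ UP.*-cong (QP.toℚᵘ-fromℚᵘ (U.mkℚᵘ (+ a) d)) (toℚᵘ-ℕ→ℚ N) ⟩
  U.mkℚᵘ (+ a) d U.* U.mkℚᵘ (+ N) 0          ≈⟨ U.*≡* cross ⟩
  U.mkℚᵘ (+ a) 0                             ≈⟨ toℚᵘ-ℕ→ℚ a ⟨
  ℚ.toℚᵘ (ℕ→ℚ a)                             ∎)
  where
  open UP.≃-Reasoning
  cross : (+ a ℤ.* + N) ℤ.* + 1 ≡ + a ℤ.* + (N ℕ.* 1)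
  cross = trans (ZP.*-assoc (+ a) (+ N) (+ 1)) (cong (+ a ℤ.*_) (sym (ZP.pos-* N 1)))

four quarter : ℚ
four    = ℕ→ℚ 4
quarter = ½ * ½

four^*quarter^ : ∀ i → four ^ i * quarter ^ i ≡ 1ℚ
four^*quarter^ zero    = refl
four^*quarter^ (suc i) = begin
  (four * four ^ i) * (quarter * quarter ^ i)  ≡⟨ interchange four (four ^ i) quarter (quarter ^ i) ⟩
  (four * quarter) * (four ^ i * quarter ^ i)  ≡⟨ cong (1ℚ *_) (four^*quarter^ i) ⟩
  1ℚ * 1ℚ                                      ≡⟨⟩
  1ℚ                                           ∎
  where
  open ≡-Reasoning
  interchange : ∀ a b c e → (a * b) * (c * e) ≡ (a * c) * (b * e)
  interchange = solve-∀ ℚ-ring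

½^2*≡quarter^ : ∀ k → ½ ^ (2 ℕ.* k) ≡ quarter ^ k
½^2*≡quarter^ k = sym (^-assocʳ ½ 2 k)

2^2*≡four^ : ∀ d → ℕ→ℚ (2 ℕ.^ (2 ℕ.* d)) ≡ four ^ d
2^2*≡four^ d = trans (ℕ→ℚ-^ 2 (2 ℕ.* d)) (sym (^-assocʳ (ℕ→ℚ 2) 2 d))

two/four^ : ∀ i → ((+ 2) / (4 ℕ.^ i)) {{NP.m^n≢0 4 i}} ≡ ℕ→ℚ 2 * quarter ^ i
two/four^ i = begin
  q                                  ≡⟨ QP.*-identityʳ q ⟨
  q * 1ℚ                             ≡⟨ cong (q *_) (four^*quarter^ i) ⟨
  q * (four ^ i * quarter ^ i)       ≡⟨ cong (λ z → q * (z * quarter ^ i)) (ℕ→ℚ-^ 4 i) ⟨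
  q * (ℕ→ℚ (4 ℕ.^ i) * quarter ^ i)  ≡⟨ QP.*-assoc q (ℕ→ℚ (4 ℕ.^ i)) (quarter ^ i) ⟨
  (q * ℕ→ℚ (4 ℕ.^ i)) * quarter ^ i  ≡⟨ cong (_* quarter ^ i) (/-cancel 2 (4 ℕ.^ i) {{NP.m^n≢0 4 i}}) ⟩
  ℕ→ℚ 2 * quarter ^ i                ∎
  where
  open ≡-Reasoning
  q = ((+ 2) / (4 ℕ.^ i)) {{NP.m^n≢0 4 i}}

sign-+ : ∀ a b → sign (a ℕ.+ b) ≡ sign a * sign b
sign-+ zero    b = sym (QP.*-identityˡ (sign b))
sign-+ (suc a) b = trans (cong -_ (sign-+ a b)) (QP.neg-distribˡ-* (sign a) (sign b))

sign-sq : ∀ m → sign m * sign m ≡ 1ℚ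
sign-sq zero    = refl
sign-sq (suc m) = trans (neg*neg (sign m)) (sign-sq m)
  where
  neg*neg : ∀ a → (- a) * (- a) ≡ a * a
  neg*neg = solve-∀ ℚ-ring

sign-even-sum : ∀ i m m' → m ℕ.+ m' ≡ 2 ℕ.* i → sign m' ≡ sign m
sign-even-sum i m m' m+m'≡2i = begin
  sign m'                        ≡⟨ QP.*-identityˡ (sign m') ⟨
  1ℚ * sign m'                   ≡⟨ cong (_* sign m') (sign-sq m) ⟨
  (sign m * sign m) * sign m'    ≡⟨ QP.*-assoc (sign m) (sign m) (sign m') ⟩
  sign m * (sign m * sign m')    ≡⟨ cong (sign m *_) (sym (sign-+ m m')) ⟩
  sign m * sign (m ℕ.+ m')       ≡⟨ cong (λ z → sign m * sign z) m+m'≡2i ⟩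
  sign m * sign (i ℕ.+ (i ℕ.+ 0)) ≡⟨ cong (sign m *_) (trans (sign-+ i (i ℕ.+ 0)) (cong (λ z → sign i * sign z) (NP.+-identityʳ i))) ⟩
  sign m * (sign i * sign i)     ≡⟨ cong (sign m *_) (sign-sq i) ⟩
  sign m * 1ℚ                    ≡⟨ QP.*-identityʳ (sign m) ⟩
  sign m                         ∎
  where open ≡-Reasoning

∑ : ℕ → (ℕ → ℚ) → ℚ
∑ p h = sumRange 0 p h

sumRange-suc : ∀ a p h → sumRange (suc a) p h ≡ sumRange a p (λ m → h (suc m))
sumRange-suc a zero    h = refl
sumRange-suc a (suc p) h = cong (_+_ (h (suc a))) (sumRange-suc (suc a) p h)

sumRange-from-0 : ∀ a p h → sumRange a p h ≡ ∑ p (λ m → h (a ℕ.+ m))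
sumRange-from-0 zero    p h = refl
sumRange-from-0 (suc a) p h = trans (sumRange-suc a p h) (sumRange-from-0 a p (λ m → h (suc m)))

sumRange-snoc : ∀ a p h → sumRange a (suc p) h ≡ sumRange a p h + h (a ℕ.+ p)
sumRange-snoc a zero    h = begin
  h a + 0ℚ        ≡⟨ QP.+-identityʳ (h a) ⟩
  h a             ≡⟨ QP.+-identityˡ (h a) ⟨
  0ℚ + h a        ≡⟨ cong (λ z → 0ℚ + h z) (NP.+-identityʳ a) ⟨
  0ℚ + h (a ℕ.+ 0) ∎
  where open ≡-Reasoning
sumRange-snoc a (suc p) h = begin
  h a + sumRange (suc a) (suc p) h                  ≡⟨ cong (_+_ (h a)) (sumRange-snoc (suc a) p h) ⟩
  h a + (sumRange (suc a) p h + h (suc a ℕ.+ p))    ≡⟨ QP.+-assoc (h a) _ _ ⟨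
  (h a + sumRange (suc a) p h) + h (suc a ℕ.+ p)    ≡⟨ cong (λ z → sumRange a (suc p) h + h z) (NP.+-suc a p) ⟨
  sumRange a (suc p) h + h (a ℕ.+ suc p)            ∎
  where open ≡-Reasoning

sumRange-cong : ∀ a p {h h'} → (∀ m → h m ≡ h' m) → sumRange a p h ≡ sumRange a p h'
sumRange-cong a zero    h≡h' = refl
sumRange-cong a (suc p) h≡h' = cong₂ _+_ (h≡h' a) (sumRange-cong (suc a) p h≡h')

∑-cong : ∀ p {h h'} → (∀ m → m < p → h m ≡ h' m) → ∑ p h ≡ ∑ p h'
∑-cong zero    h≡h' = refl
∑-cong (suc p) {h} {h'} h≡h' = cong₂ _+_ (h≡h' 0 (s≤s ℕ.z≤n)) (begin
  sumRange 1 p h                ≡⟨ sumRange-suc 0 p h ⟩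
  ∑ p (λ m → h (suc m))         ≡⟨ ∑-cong p (λ m m<p → h≡h' (suc m) (s≤s m<p)) ⟩
  ∑ p (λ m → h' (suc m))        ≡⟨ sumRange-suc 0 p h' ⟨
  sumRange 1 p h'               ∎)
  where open ≡-Reasoning

sumRange-+ : ∀ a p h g → sumRange a p (λ m → h m + g m) ≡ sumRange a p h + sumRange a p g
sumRange-+ a zero    h g = refl
sumRange-+ a (suc p) h g =
  trans (cong (_+_ (h a + g a)) (sumRange-+ (suc a) p h g)) (interchange (h a) (g a) _ _)
  where
  interchange : ∀ x y X Y → (x + y) + (X + Y) ≡ (x + X) + (y + Y)
  interchange = solve-∀ ℚ-ring

sumRange-*ˡ : ∀ a p q h → sumRange a p (λ m → q * h m) ≡ q * sumRange a p h
sumRange-*ˡ a zero    q h = sym (QP.*-zeroʳ q)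
sumRange-*ˡ a (suc p) q h =
  trans (cong (_+_ (q * h a)) (sumRange-*ˡ (suc a) p q h)) (sym (QP.*-distribˡ-+ q (h a) _))

sumRange-++ : ∀ a p q h → sumRange a (p ℕ.+ q) h ≡ sumRange a p h + sumRange (a ℕ.+ p) q h
sumRange-++ a zero    q h =
  trans (cong (λ z → sumRange z q h) (sym (NP.+-identityʳ a))) (sym (QP.+-identityˡ _))
sumRange-++ a (suc p) q h = begin
  h a + sumRange (suc a) (p ℕ.+ q) h                            ≡⟨ cong (_+_ (h a)) (sumRange-++ (suc a) p q h) ⟩
  h a + (sumRange (suc a) p h + sumRange (suc a ℕ.+ p) q h)     ≡⟨ QP.+-assoc (h a) _ _ ⟨
  sumRange a (suc p) h + sumRange (suc a ℕ.+ p) q h             ≡⟨ cong (λ z → sumRange a (suc p) h + sumRange z q h) (NP.+-suc a p) ⟨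
  sumRange a (suc p) h + sumRange (a ℕ.+ suc p) q h             ∎
  where open ≡-Reasoning

∑-reverse : ∀ p h → ∑ p h ≡ ∑ p (λ m → h (p ∸ suc m))
∑-reverse zero    h = refl
∑-reverse (suc p) h = begin
  ∑ (suc p) h                                   ≡⟨ sumRange-snoc 0 p h ⟩
  ∑ p h + h p                                   ≡⟨ QP.+-comm (∑ p h) (h p) ⟩
  h p + ∑ p h                                   ≡⟨ cong (_+_ (h p)) (∑-reverse p h) ⟩
  h p + ∑ p (λ m → h (p ∸ suc m))               ≡⟨ cong (_+_ (h p)) (sumRange-suc 0 p (λ m → h (suc p ∸ suc m))) ⟨
  ∑ (suc p) (λ m → h (suc p ∸ suc m))           ∎
  where open ≡-Reasoning

∑-zero : ∀ p h → (∀ m → m < p → h m ≡ 0ℚ) → ∑ p h ≡ 0ℚ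
∑-zero p h h≡0 = trans (∑-cong p h≡0) (zeros 0 p)
  where
  zeros : ∀ a p → sumRange a p (λ _ → 0ℚ) ≡ 0ℚ
  zeros a zero    = refl
  zeros a (suc p) = cong (_+_ 0ℚ) (zeros (suc a) p)

∑-drop-zeros : ∀ q p h → q ≤ p → (∀ m → q ≤ m → h m ≡ 0ℚ) → ∑ p h ≡ ∑ q h
∑-drop-zeros q p h q≤p h≡0 = begin
  ∑ p h                                      ≡⟨ cong (λ z → ∑ z h) (NP.m+[n∸m]≡n q≤p) ⟨
  ∑ (q ℕ.+ (p ∸ q)) h                        ≡⟨ sumRange-++ 0 q (p ∸ q) h ⟩
  ∑ q h + sumRange q (p ∸ q) h               ≡⟨ cong (_+_ (∑ q h)) tail≡0 ⟩
  ∑ q h + 0ℚ                                 ≡⟨ QP.+-identityʳ (∑ q h) ⟩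
  ∑ q h                                      ∎
  where
  open ≡-Reasoning
  tail≡0 : sumRange q (p ∸ q) h ≡ 0ℚ
  tail≡0 = trans (sumRange-from-0 q (p ∸ q) h) (∑-zero (p ∸ q) _ (λ m _ → h≡0 (q ℕ.+ m) (NP.m≤m+n q m)))

∑-pascal : ∀ r (a : ℕ → ℚ) →
  ∑ (suc (suc r)) (λ m → ℕ→ℚ (suc r C m) * a m)
    ≡ ∑ (suc r) (λ m → ℕ→ℚ (r C m) * a m) + ∑ (suc r) (λ m → ℕ→ℚ (r C m) * a (suc m))
∑-pascal r a = begin
  ∑ (suc (suc r)) (λ m → ℕ→ℚ (suc r C m) * a m)
    ≡⟨ cong (_+_ a0) (sumRange-suc 0 (suc r) (λ m → ℕ→ℚ (suc r C m) * a m)) ⟩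
  a0 + ∑ (suc r) (λ m → ℕ→ℚ (suc r C suc m) * a (suc m))
    ≡⟨ cong (_+_ a0) (sumRange-cong 0 (suc r) split-binomial) ⟩
  a0 + ∑ (suc r) (λ m → lower m + upper m)
    ≡⟨ cong (_+_ a0) (sumRange-+ 0 (suc r) lower upper) ⟩
  a0 + (∑ (suc r) lower + ∑ (suc r) upper)
    ≡⟨ cong (λ z → a0 + (∑ (suc r) lower + z)) (sumRange-snoc 0 r upper) ⟩
  a0 + (∑ (suc r) lower + (∑ r upper + upper r))
    ≡⟨ cong (λ z → a0 + (∑ (suc r) lower + (∑ r upper + z))) last-upper≡0 ⟩
  a0 + (∑ (suc r) lower + (∑ r upper + 0ℚ))
    ≡⟨ regroup a0 (∑ (suc r) lower) (∑ r upper) ⟩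
  (a0 + ∑ r upper) + ∑ (suc r) lower
    ≡⟨ cong (λ z → (a0 + z) + ∑ (suc r) lower) (sumRange-suc 0 r (λ m → ℕ→ℚ (r C m) * a m)) ⟨
  ∑ (suc r) (λ m → ℕ→ℚ (r C m) * a m) + ∑ (suc r) lower ∎
  where
  open ≡-Reasoning
  a0 = ℕ→ℚ 1 * a 0
  lower upper : ℕ → ℚ
  lower m = ℕ→ℚ (r C m) * a (suc m)
  upper m = ℕ→ℚ (r C suc m) * a (suc m)
  split-binomial : ∀ m → ℕ→ℚ (suc r C suc m) * a (suc m) ≡ lower m + upper m
  split-binomial m = begin
    ℕ→ℚ (suc r C suc m) * a (suc m)                  ≡⟨ cong (λ z → ℕ→ℚ z * a (suc m)) (nCk+nC[k+1]≡[n+1]C[k+1] r m) ⟨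
    ℕ→ℚ (r C m ℕ.+ r C suc m) * a (suc m)            ≡⟨ cong (_* a (suc m)) (ℕ→ℚ-+ (r C m) (r C suc m)) ⟩
    (ℕ→ℚ (r C m) + ℕ→ℚ (r C suc m)) * a (suc m)      ≡⟨ QP.*-distribʳ-+ (a (suc m)) (ℕ→ℚ (r C m)) (ℕ→ℚ (r C suc m)) ⟩
    lower m + upper m                                ∎
  last-upper≡0 : upper r ≡ 0ℚ
  last-upper≡0 = trans (cong (λ z → ℕ→ℚ z * a (suc r)) (k>n⇒nCk≡0 (NP.n<1+n r))) (QP.*-zeroˡ (a (suc r)))
  regroup : ∀ x y z → x + (y + (z + 0ℚ)) ≡ (x + z) + y
  regroup = solve-∀ ℚ-ring

Fun : Set
Fun = ℚ → ℚ

Op : Set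
Op = Fun → Fun

_^[_] : Op → ℕ → Op
(A ^[ r ]) f = iterate A f r

^[]-+ : ∀ A a b f → (A ^[ a ℕ.+ b ]) f ≡ (A ^[ b ]) ((A ^[ a ]) f)
^[]-+ A zero    b f = refl
^[]-+ A (suc a) b f = ^[]-+ A a b (A f)

^[]-2*suc : ∀ A k f → (A ^[ 2 ℕ.* suc k ]) f ≡ (A ^[ 2 ℕ.* k ]) (A (A f))
^[]-2*suc A k f = cong (λ r → (A ^[ r ]) f) (NP.*-suc 2 k)

record IsLinear (A : Op) : Set where
  field
    ext : ∀ {f g} → (∀ y → f y ≡ g y) → ∀ x → A f x ≡ A g x
    lin : ∀ p q f g x → A (λ y → p * f y + q * g y) x ≡ p * A f x + q * A g x

  scale : ∀ p f x → A (λ y → p * f y) x ≡ p * A f x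
  scale p f x = begin
    A (λ y → p * f y) x                  ≡⟨ ext (λ y → sym (drop (p * f y) (f y))) x ⟩
    A (λ y → p * f y + 0ℚ * f y) x       ≡⟨ lin p 0ℚ f f x ⟩
    p * A f x + 0ℚ * A f x               ≡⟨ drop (p * A f x) (A f x) ⟩
    p * A f x                            ∎
    where
    open ≡-Reasoning
    drop : ∀ u v → u + 0ℚ * v ≡ u
    drop = solve-∀ ℚ-ring

  kills-zero : ∀ x → A (λ _ → 0ℚ) x ≡ 0ℚ
  kills-zero x = trans (scale 0ℚ (λ _ → 0ℚ) x) (QP.*-zeroˡ (A (λ _ → 0ℚ) x))

open IsLinear

^[]-ext : ∀ {A} → IsLinear A → ∀ r {f g} → (∀ y → f y ≡ g y) → ∀ x → (A ^[ r ]) f x ≡ (A ^[ r ]) g x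
^[]-ext A-lin zero    f≡g = f≡g
^[]-ext A-lin (suc r) f≡g = ^[]-ext A-lin r (ext A-lin f≡g)

^[]-linear : ∀ {A} → IsLinear A → ∀ r → IsLinear (A ^[ r ])
^[]-linear A-lin r .ext = ^[]-ext A-lin r
^[]-linear A-lin zero    .lin p q f g x = refl
^[]-linear {A} A-lin (suc r) .lin p q f g x =
  trans (^[]-ext A-lin r (lin A-lin p q f g) x) (lin (^[]-linear A-lin r) p q (A f) (A g) x)

^[]-comm : ∀ {A B} → IsLinear A → IsLinear B → (∀ f x → B (A f) x ≡ A (B f) x) →
  ∀ r f x → B ((A ^[ r ]) f) x ≡ (A ^[ r ]) (B f) x
^[]-comm A-lin B-lin BA≡AB zero    f x = refl
^[]-comm A-lin B-lin BA≡AB (suc r) f x =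
  trans (^[]-comm A-lin B-lin BA≡AB r _ x) (^[]-ext A-lin r (BA≡AB f) x)

two : ℚ
two = 1ℚ + 1ℚ

δ μ δ₂ : Op
δ f x  = f (x + 1ℚ) - f (x - 1ℚ)
μ f x  = ½ * (f (x + 1ℚ) + f (x - 1ℚ))
δ₂ f x = f (x + two) - f (x - two)

δ-linear : IsLinear δ
δ-linear .ext f≡g x = cong₂ _-_ (f≡g _) (f≡g _)
δ-linear .lin p q f g x = rearrange p q (f _) (g _) (f _) (g _)
  where
  rearrange : ∀ p q a b a' b' → (p * a + q * b) - (p * a' + q * b') ≡ p * (a - a') + q * (b - b')
  rearrange = solve-∀ ℚ-ring

μ-linear : IsLinear μ
μ-linear .ext f≡g x = cong (½ *_) (cong₂ _+_ (f≡g _) (f≡g _))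
μ-linear .lin p q f g x = rearrange p q (f _) (g _) (f _) (g _)
  where
  rearrange : ∀ p q a b a' b' → ½ * ((p * a + q * b) + (p * a' + q * b')) ≡ p * (½ * (a + a')) + q * (½ * (b + b'))
  rearrange = solve-∀ ℚ-ring

step-back : ∀ x → (x + 1ℚ) - 1ℚ ≡ x
step-back = solve-∀ ℚ-ring

step-forth : ∀ x → (x - 1ℚ) + 1ℚ ≡ x
step-forth = solve-∀ ℚ-ring

double-step-+ : ∀ x → (x + 1ℚ) + 1ℚ ≡ x + two
double-step-+ = solve-∀ ℚ-ring

double-step-- : ∀ x → (x - 1ℚ) - 1ℚ ≡ x - two
double-step-- = solve-∀ ℚ-ring

μδ≡δμ : ∀ f x → μ (δ f) x ≡ δ (μ f) x
μδ≡δμ f x rewrite step-back x | step-forth x = regroup (f _) (f x) (f _)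
  where
  regroup : ∀ a b c → ½ * ((a - b) + (b - c)) ≡ ½ * (a + b) - ½ * (b + c)
  regroup = solve-∀ ℚ-ring

μδ≡½δ₂ : ∀ f x → μ (δ f) x ≡ ½ * δ₂ f x
μδ≡½δ₂ f x rewrite step-back x | step-forth x | double-step-+ x | double-step-- x = telescope (f _) (f x) (f _)
  where
  telescope : ∀ a b c → ½ * ((a - b) + (b - c)) ≡ ½ * (a - c)
  telescope = solve-∀ ℚ-ring

-- μ² = 1 + ¼ δ² (the coefficient 1 is kept visible for linearity of δ^r).
μμ≡1+¼δδ : ∀ f x → μ (μ f) x ≡ 1ℚ * f x + quarter * δ (δ f) x
μμ≡1+¼δδ f x rewrite step-back x | step-forth x = expand (f _) (f x) (f _)
  where
  expand : ∀ a b c → ½ * (½ * (a + b) + ½ * (b + c)) ≡ 1ℚ * b + (½ * ½) * ((a - b) - (b - c))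
  expand = solve-∀ ℚ-ring

-- μ^r δ^r = ½^r δ₂^r, from μ δ = ½ δ₂ and commutativity.
μ^rδ^r≡½^rδ₂^r : ∀ r f x → (μ ^[ r ]) ((δ ^[ r ]) f) x ≡ ½ ^ r * (δ₂ ^[ r ]) f x
μ^rδ^r≡½^rδ₂^r zero    f x = sym (QP.*-identityˡ (f x))
μ^rδ^r≡½^rδ₂^r (suc r) f x = begin
  (μ ^[ r ]) (μ ((δ ^[ r ]) (δ f))) x
    ≡⟨ ^[]-ext μ-linear r (^[]-comm δ-linear μ-linear μδ≡δμ r (δ f)) x ⟩
  (μ ^[ r ]) ((δ ^[ r ]) (μ (δ f))) x
    ≡⟨ ^[]-ext μ-linear r (^[]-ext δ-linear r (μδ≡½δ₂ f)) x ⟩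
  (μ ^[ r ]) ((δ ^[ r ]) (λ y → ½ * δ₂ f y)) x
    ≡⟨ ^[]-ext μ-linear r (scale (^[]-linear δ-linear r) ½ (δ₂ f)) x ⟩
  (μ ^[ r ]) (λ y → ½ * (δ ^[ r ]) (δ₂ f) y) x
    ≡⟨ scale (^[]-linear μ-linear r) ½ ((δ ^[ r ]) (δ₂ f)) x ⟩
  ½ * (μ ^[ r ]) ((δ ^[ r ]) (δ₂ f)) x
    ≡⟨ cong (½ *_) (μ^rδ^r≡½^rδ₂^r r (δ₂ f) x) ⟩
  ½ * (½ ^ r * (δ₂ ^[ r ]) (δ₂ f) x)
    ≡⟨ QP.*-assoc ½ (½ ^ r) _ ⟨
  ½ ^ suc r * (δ₂ ^[ suc r ]) f x ∎
  where open ≡-Reasoning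

δ₂^r-dilation : ∀ r f x → (δ₂ ^[ r ]) f (x + x) ≡ (δ ^[ r ]) (λ y → f (y + y)) x
δ₂^r-dilation zero    f x = refl
δ₂^r-dilation (suc r) f x =
  trans (δ₂^r-dilation r (δ₂ f) x) (^[]-ext δ-linear r dilate-once x)
  where
  forth : ∀ y → (y + y) + two ≡ (y + 1ℚ) + (y + 1ℚ)
  forth = solve-∀ ℚ-ring
  back : ∀ y → (y + y) - two ≡ (y - 1ℚ) + (y - 1ℚ)
  back = solve-∀ ℚ-ring
  dilate-once : ∀ y → δ₂ f (y + y) ≡ δ (λ z → f (z + z)) y
  dilate-once y = cong₂ _-_ (cong f (forth y)) (cong f (back y))

-- Binomial theorem for μ² = 1 + ¼δ²:  μ^(2k) = Σ_m C(k,m) ¼^m δ^(2m).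
μ^2k-binomial : ∀ k f x →
  (μ ^[ 2 ℕ.* k ]) f x ≡ ∑ (suc k) (λ m → ℕ→ℚ (k C m) * (quarter ^ m * (δ ^[ 2 ℕ.* m ]) f x))
μ^2k-binomial zero    f x = unit (f x)
  where
  unit : ∀ a → a ≡ 1ℚ * (1ℚ * a) + 0ℚ
  unit = solve-∀ ℚ-ring
μ^2k-binomial (suc k) f x = begin
  (μ ^[ 2 ℕ.* suc k ]) f x
    ≡⟨ cong (λ g → g x) (^[]-2*suc μ k f) ⟩
  (μ ^[ 2 ℕ.* k ]) (μ (μ f)) x
    ≡⟨ μ^2k-binomial k (μ (μ f)) x ⟩
  ∑ (suc k) (λ m → ℕ→ℚ (k C m) * (quarter ^ m * (δ ^[ 2 ℕ.* m ]) (μ (μ f)) x))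
    ≡⟨ sumRange-cong 0 (suc k) expand ⟩
  ∑ (suc k) (λ m → ℕ→ℚ (k C m) * a m + ℕ→ℚ (k C m) * a (suc m))
    ≡⟨ sumRange-+ 0 (suc k) (λ m → ℕ→ℚ (k C m) * a m) (λ m → ℕ→ℚ (k C m) * a (suc m)) ⟩
  ∑ (suc k) (λ m → ℕ→ℚ (k C m) * a m) + ∑ (suc k) (λ m → ℕ→ℚ (k C m) * a (suc m))
    ≡⟨ ∑-pascal k a ⟨
  ∑ (suc (suc k)) (λ m → ℕ→ℚ (suc k C m) * a m) ∎
  where
  open ≡-Reasoning
  a : ℕ → ℚ
  a m = quarter ^ m * (δ ^[ 2 ℕ.* m ]) f x
  distribute : ∀ b w u v → b * (w * (1ℚ * u + quarter * v)) ≡ b * (w * u) + b * ((quarter * w) * v)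
  distribute = solve-∀ ℚ-ring
  expand : ∀ m → ℕ→ℚ (k C m) * (quarter ^ m * (δ ^[ 2 ℕ.* m ]) (μ (μ f)) x)
                 ≡ ℕ→ℚ (k C m) * a m + ℕ→ℚ (k C m) * a (suc m)
  expand m = begin
    ℕ→ℚ (k C m) * (quarter ^ m * (δ ^[ 2 ℕ.* m ]) (μ (μ f)) x)
      ≡⟨ cong (λ z → ℕ→ℚ (k C m) * (quarter ^ m * z)) (trans
           (^[]-ext δ-linear (2 ℕ.* m) (μμ≡1+¼δδ f) x)
           (lin (^[]-linear δ-linear (2 ℕ.* m)) 1ℚ quarter f (δ (δ f)) x)) ⟩
    ℕ→ℚ (k C m) * (quarter ^ m * (1ℚ * (δ ^[ 2 ℕ.* m ]) f x + quarter * (δ ^[ 2 ℕ.* m ]) (δ (δ f)) x))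
      ≡⟨ distribute (ℕ→ℚ (k C m)) (quarter ^ m) _ _ ⟩
    ℕ→ℚ (k C m) * a m + ℕ→ℚ (k C m) * (quarter ^ suc m * (δ ^[ 2 ℕ.* m ]) (δ (δ f)) x)
      ≡⟨ cong (λ g → ℕ→ℚ (k C m) * a m + ℕ→ℚ (k C m) * (quarter ^ suc m * g x)) (^[]-2*suc δ m f) ⟨
    ℕ→ℚ (k C m) * a m + ℕ→ℚ (k C m) * a (suc m) ∎

-- The nodes x + r − 2m (0 ≤ m ≤ r) at which δ^r f (x) samples f.
node : ℚ → ℕ → ℕ → ℚ
node x r m = x + (ℕ→ℚ r - (ℕ→ℚ m + ℕ→ℚ m))

node-+1 : ∀ x r m → node x r m + 1ℚ ≡ node x (suc r) m
node-+1 x r m = trans (shift x (ℕ→ℚ r) (ℕ→ℚ m)) (cong (λ z → x + (z - (ℕ→ℚ m + ℕ→ℚ m))) (sym (ℕ→ℚ-suc r)))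
  where
  shift : ∀ x R M → (x + (R - (M + M))) + 1ℚ ≡ x + ((1ℚ + R) - (M + M))
  shift = solve-∀ ℚ-ring

node--1 : ∀ x r m → node x r m - 1ℚ ≡ node x (suc r) (suc m)
node--1 x r m =
  trans (shift x (ℕ→ℚ r) (ℕ→ℚ m)) (cong₂ (λ R M → x + (R - (M + M))) (sym (ℕ→ℚ-suc r)) (sym (ℕ→ℚ-suc m)))
  where
  shift : ∀ x R M → (x + (R - (M + M))) - 1ℚ ≡ x + ((1ℚ + R) - ((1ℚ + M) + (1ℚ + M)))
  shift = solve-∀ ℚ-ring

stencil : Fun → ℚ → ℕ → ℕ → ℚ
stencil f x r m = ℕ→ℚ (r C m) * (sign m * f (node x r m))

δ^r-expansion : ∀ r f x → (δ ^[ r ]) f x ≡ ∑ (suc r) (stencil f x r)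
δ^r-expansion zero    f x = trans (cong f (at-x x)) (unit (f (node x 0 0)))
  where
  at-x : ∀ x → x ≡ x + (0ℚ - (0ℚ + 0ℚ))
  at-x = solve-∀ ℚ-ring
  unit : ∀ a → a ≡ 1ℚ * (1ℚ * a) + 0ℚ
  unit = solve-∀ ℚ-ring
δ^r-expansion (suc r) f x = begin
  (δ ^[ r ]) (δ f) x
    ≡⟨ δ^r-expansion r (δ f) x ⟩
  ∑ (suc r) (stencil (δ f) x r)
    ≡⟨ sumRange-cong 0 (suc r) split ⟩
  ∑ (suc r) (λ m → ℕ→ℚ (r C m) * a m + ℕ→ℚ (r C m) * a (suc m))
    ≡⟨ sumRange-+ 0 (suc r) (λ m → ℕ→ℚ (r C m) * a m) (λ m → ℕ→ℚ (r C m) * a (suc m)) ⟩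
  ∑ (suc r) (λ m → ℕ→ℚ (r C m) * a m) + ∑ (suc r) (λ m → ℕ→ℚ (r C m) * a (suc m))
    ≡⟨ ∑-pascal r a ⟨
  ∑ (suc (suc r)) (stencil f x (suc r)) ∎
  where
  open ≡-Reasoning
  a : ℕ → ℚ
  a m = sign m * f (node x (suc r) m)
  distribute : ∀ b s u v → b * (s * (u - v)) ≡ b * (s * u) + b * ((- s) * v)
  distribute = solve-∀ ℚ-ring
  split : ∀ m → stencil (δ f) x r m ≡ ℕ→ℚ (r C m) * a m + ℕ→ℚ (r C m) * a (suc m)
  split m = trans
    (cong (λ z → ℕ→ℚ (r C m) * (sign m * z)) (cong₂ _-_ (cong f (node-+1 x r m)) (cong f (node--1 x r m))))
    (distribute (ℕ→ℚ (r C m)) (sign m) _ _)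

δ-leibniz : ∀ g x → δ (λ y → y * g y) x ≡ x * δ g x + two * μ g x
δ-leibniz g x = expand x (g _) (g _)
  where
  expand : ∀ x a b → (x + 1ℚ) * a - (x - 1ℚ) * b ≡ x * (a - b) + two * (½ * (a + b))
  expand = solve-∀ ℚ-ring

-- Iterated (using μ δ = δ μ): δ^(r+1) (y g) (x) = x · δ^(r+1) g (x) + 2(r+1) · δ^r (μ g) (x);
-- needed to show that δ^r lowers the degree of polynomials.
δ^r-leibniz : ∀ r g x →
  (δ ^[ suc r ]) (λ y → y * g y) x ≡ x * (δ ^[ suc r ]) g x + two * ℕ→ℚ (suc r) * (δ ^[ r ]) (μ g) x
δ^r-leibniz zero    g x = δ-leibniz g x
δ^r-leibniz (suc r) g x = begin
  (δ ^[ suc r ]) (δ (λ y → y * g y)) x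
    ≡⟨ ^[]-ext δ-linear (suc r) (λ y → trans (δ-leibniz g y) (cong (_+ two * μ g y) (sym (QP.*-identityˡ (y * δ g y))))) x ⟩
  (δ ^[ suc r ]) (λ y → 1ℚ * (y * δ g y) + two * μ g y) x
    ≡⟨ lin (^[]-linear δ-linear (suc r)) 1ℚ two (λ y → y * δ g y) (μ g) x ⟩
  1ℚ * (δ ^[ suc r ]) (λ y → y * δ g y) x + two * (δ ^[ suc r ]) (μ g) x
    ≡⟨ cong (λ z → 1ℚ * z + two * (δ ^[ suc r ]) (μ g) x) (δ^r-leibniz r (δ g) x) ⟩
  1ℚ * (x * A + two * ℕ→ℚ (suc r) * (δ ^[ r ]) (μ (δ g)) x) + two * B
    ≡⟨ cong (λ z → 1ℚ * (x * A + two * ℕ→ℚ (suc r) * z) + two * B) (^[]-ext δ-linear r (μδ≡δμ g) x) ⟩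
  1ℚ * (x * A + two * ℕ→ℚ (suc r) * B) + two * B
    ≡⟨ collect x A (ℕ→ℚ (suc r)) B ⟩
  x * A + two * (1ℚ + ℕ→ℚ (suc r)) * B
    ≡⟨ cong (λ z → x * A + two * z * B) (ℕ→ℚ-suc (suc r)) ⟨
  x * A + two * ℕ→ℚ (suc (suc r)) * B ∎
  where
  open ≡-Reasoning
  A B : ℚ
  A = (δ ^[ suc (suc r) ]) g x
  B = (δ ^[ suc r ]) (μ g) x
  collect : ∀ x A c B → 1ℚ * (x * A + two * c * B) + two * B ≡ x * A + two * (1ℚ + c) * B
  collect = solve-∀ ℚ-ring

δ^r-kills-low-powers : ∀ e r x → e < r → (δ ^[ r ]) (λ y → y ^ e) x ≡ 0ℚ
δ^r-kills-low-powers zero    (suc r) x _ =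
  trans (^[]-ext δ-linear r (λ _ → refl) x) (kills-zero (^[]-linear δ-linear r) x)
δ^r-kills-low-powers (suc e) (suc r) x (s≤s e<r) = begin
  (δ ^[ suc r ]) (λ y → y * y ^ e) x
    ≡⟨ δ^r-leibniz r (λ y → y ^ e) x ⟩
  x * (δ ^[ suc r ]) (λ y → y ^ e) x + two * ℕ→ℚ (suc r) * (δ ^[ r ]) (μ (λ y → y ^ e)) x
    ≡⟨ cong₂ (λ u v → x * u + two * ℕ→ℚ (suc r) * v)
         (δ^r-kills-low-powers e (suc r) x (NP.m<n⇒m<1+n e<r))
         (sym (^[]-comm δ-linear μ-linear μδ≡δμ r (λ y → y ^ e) x)) ⟩
  x * 0ℚ + two * ℕ→ℚ (suc r) * μ ((δ ^[ r ]) (λ y → y ^ e)) x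
    ≡⟨ cong (λ z → x * 0ℚ + two * ℕ→ℚ (suc r) * (½ * z))
         (cong₂ _+_ (δ^r-kills-low-powers e r _ e<r) (δ^r-kills-low-powers e r _ e<r)) ⟩
  x * 0ℚ + two * ℕ→ℚ (suc r) * (½ * (0ℚ + 0ℚ))
    ≡⟨ vanish x (two * ℕ→ℚ (suc r)) ⟩
  0ℚ ∎
  where
  open ≡-Reasoning
  vanish : ∀ x c → x * 0ℚ + c * (½ * (0ℚ + 0ℚ)) ≡ 0ℚ
  vanish = solve-∀ ℚ-ring

evenPow : ℕ → Fun
evenPow n y = y ^ (2 ℕ.* n)

evenPow-even : ∀ n y → evenPow n (- y) ≡ evenPow n y
evenPow-even n y = begin
  (- y) ^ (2 ℕ.* n)   ≡⟨ ^-assocʳ (- y) 2 n ⟨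
  ((- y) ^ 2) ^ n     ≡⟨ cong (_^ n) (neg-square y) ⟩
  (y ^ 2) ^ n         ≡⟨ ^-assocʳ y 2 n ⟩
  y ^ (2 ℕ.* n)       ∎
  where
  open ≡-Reasoning
  neg-square : ∀ y → (- y) * ((- y) * 1ℚ) ≡ y * (y * 1ℚ)
  neg-square = solve-∀ ℚ-ring

evenPow-dilate : ∀ n y → evenPow n (y + y) ≡ four ^ n * evenPow n y
evenPow-dilate n y = begin
  (y + y) ^ (2 ℕ.* n)                ≡⟨ cong (_^ (2 ℕ.* n)) (double y) ⟩
  (two * y) ^ (2 ℕ.* n)              ≡⟨ ^-distrib-* two y (2 ℕ.* n) ⟩
  two ^ (2 ℕ.* n) * y ^ (2 ℕ.* n)    ≡⟨ cong (_* y ^ (2 ℕ.* n)) (^-assocʳ two 2 n) ⟨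
  four ^ n * y ^ (2 ℕ.* n)           ∎
  where
  open ≡-Reasoning
  double : ∀ y → y + y ≡ two * y
  double = solve-∀ ℚ-ring

-- (For evenPow-0: 2·(n+1) reduces to the successor of n + 1·(n+1), so 0^(2(n+1)) = 0 · 0^(…).)
evenPow-0 : ∀ n → 1 ≤ n → evenPow n 0ℚ ≡ 0ℚ
evenPow-0 (suc n) _ = QP.*-zeroˡ (0ℚ ^ (n ℕ.+ 1 ℕ.* suc n))

cTerm : ℕ → ℕ → ℕ → ℚ
cTerm n i j = sign (i ∸ j) * ℕ→ℚ (((2 ℕ.* i) C (i ∸ j)) ℕ.* ((2 ℕ.* j) ℕ.^ (2 ℕ.* n)))

stencil-symmetric : ∀ f → (∀ y → f (- y) ≡ f y) → ∀ i m m' → m ℕ.+ m' ≡ 2 ℕ.* i →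
  stencil f 0ℚ (2 ℕ.* i) m' ≡ stencil f 0ℚ (2 ℕ.* i) m
stencil-symmetric f f-even i m m' m+m'≡2i =
  cong₂ _*_ (cong ℕ→ℚ binomial-symmetric) (cong₂ _*_ (sign-even-sum i m m' m+m'≡2i) value-symmetric)
  where
  ℕ→ℚ-2i : ℕ→ℚ (2 ℕ.* i) ≡ ℕ→ℚ m + ℕ→ℚ m'
  ℕ→ℚ-2i = trans (cong ℕ→ℚ (sym m+m'≡2i)) (ℕ→ℚ-+ m m')
  binomial-symmetric : 2 ℕ.* i C m' ≡ 2 ℕ.* i C m
  binomial-symmetric = begin
    2 ℕ.* i C m'                    ≡⟨ cong (λ r → r C m') m+m'≡2i ⟨
    (m ℕ.+ m') C m'                 ≡⟨ nCk≡nC[n∸k] (NP.m≤n+m m' m) ⟩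
    (m ℕ.+ m') C (m ℕ.+ m' ∸ m')    ≡⟨ cong ((m ℕ.+ m') C_) (NP.m+n∸n≡m m m') ⟩
    (m ℕ.+ m') C m                  ≡⟨ cong (λ r → r C m) m+m'≡2i ⟩
    2 ℕ.* i C m                     ∎
    where open ≡-Reasoning
  mirror : ∀ M M' → 0ℚ + ((M + M') - (M' + M')) ≡ - (0ℚ + ((M + M') - (M + M)))
  mirror = solve-∀ ℚ-ring
  value-symmetric : f (node 0ℚ (2 ℕ.* i) m') ≡ f (node 0ℚ (2 ℕ.* i) m)
  value-symmetric = begin
    f (node 0ℚ (2 ℕ.* i) m')                           ≡⟨ cong (λ R → f (0ℚ + (R - (ℕ→ℚ m' + ℕ→ℚ m')))) ℕ→ℚ-2i ⟩
    f (0ℚ + ((ℕ→ℚ m + ℕ→ℚ m') - (ℕ→ℚ m' + ℕ→ℚ m')))    ≡⟨ cong f (mirror (ℕ→ℚ m) (ℕ→ℚ m')) ⟩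
    f (- (0ℚ + ((ℕ→ℚ m + ℕ→ℚ m') - (ℕ→ℚ m + ℕ→ℚ m))))  ≡⟨ f-even _ ⟩
    f (0ℚ + ((ℕ→ℚ m + ℕ→ℚ m') - (ℕ→ℚ m + ℕ→ℚ m)))      ≡⟨ cong (λ R → f (0ℚ + (R - (ℕ→ℚ m + ℕ→ℚ m)))) ℕ→ℚ-2i ⟨
    f (node 0ℚ (2 ℕ.* i) m)                            ∎
    where open ≡-Reasoning

-- The middle term of the expansion of δ^(2i) f (0) samples f at 0.
stencil-middle : ∀ f → f 0ℚ ≡ 0ℚ → ∀ i → stencil f 0ℚ (2 ℕ.* i) i ≡ 0ℚ
stencil-middle f f0≡0 i = begin
  ℕ→ℚ (2 ℕ.* i C i) * (sign i * f (node 0ℚ (2 ℕ.* i) i))  ≡⟨ cong (λ z → ℕ→ℚ (2 ℕ.* i C i) * (sign i * f z)) node≡0 ⟩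
  ℕ→ℚ (2 ℕ.* i C i) * (sign i * f 0ℚ)                     ≡⟨ cong (λ z → ℕ→ℚ (2 ℕ.* i C i) * (sign i * z)) f0≡0 ⟩
  ℕ→ℚ (2 ℕ.* i C i) * (sign i * 0ℚ)                       ≡⟨ vanish (ℕ→ℚ (2 ℕ.* i C i)) (sign i) ⟩
  0ℚ                                                      ∎
  where
  open ≡-Reasoning
  centre : ∀ I → 0ℚ + ((I + I) - (I + I)) ≡ 0ℚ
  centre = solve-∀ ℚ-ring
  node≡0 : node 0ℚ (2 ℕ.* i) i ≡ 0ℚ
  node≡0 = trans (cong (λ R → 0ℚ + (R - (ℕ→ℚ i + ℕ→ℚ i))) (ℕ→ℚ-2* i)) (centre (ℕ→ℚ i))
  vanish : ∀ b s → b * (s * 0ℚ) ≡ 0ℚ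
  vanish = solve-∀ ℚ-ring

stencil-evenPow : ∀ n i m j → m ℕ.+ j ≡ i → stencil (evenPow n) 0ℚ (2 ℕ.* i) m ≡ cTerm n i j
stencil-evenPow n i m j m+j≡i = begin
  ℕ→ℚ (2 ℕ.* i C m) * (sign m * evenPow n (node 0ℚ (2 ℕ.* i) m))
    ≡⟨ cong (λ z → ℕ→ℚ (2 ℕ.* i C m) * (sign m * evenPow n z)) node≡2j ⟩
  ℕ→ℚ (2 ℕ.* i C m) * (sign m * ℕ→ℚ (2 ℕ.* j) ^ (2 ℕ.* n))
    ≡⟨ cong (λ z → ℕ→ℚ (2 ℕ.* i C m) * (sign m * z)) (ℕ→ℚ-^ (2 ℕ.* j) (2 ℕ.* n)) ⟨
  ℕ→ℚ (2 ℕ.* i C m) * (sign m * ℕ→ℚ ((2 ℕ.* j) ℕ.^ (2 ℕ.* n)))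
    ≡⟨ swap (ℕ→ℚ (2 ℕ.* i C m)) (sign m) _ ⟩
  sign m * (ℕ→ℚ (2 ℕ.* i C m) * ℕ→ℚ ((2 ℕ.* j) ℕ.^ (2 ℕ.* n)))
    ≡⟨ cong (sign m *_) (ℕ→ℚ-* (2 ℕ.* i C m) _) ⟨
  sign m * ℕ→ℚ ((2 ℕ.* i C m) ℕ.* ((2 ℕ.* j) ℕ.^ (2 ℕ.* n)))
    ≡⟨ cong (λ z → sign z * ℕ→ℚ ((2 ℕ.* i C z) ℕ.* ((2 ℕ.* j) ℕ.^ (2 ℕ.* n)))) i∸j≡m ⟨
  cTerm n i j ∎
  where
  open ≡-Reasoning
  i∸j≡m : i ∸ j ≡ m
  i∸j≡m = trans (cong (_∸ j) (sym m+j≡i)) (NP.m+n∸n≡m m j)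
  offset : ∀ M J → 0ℚ + (((M + J) + (M + J)) - (M + M)) ≡ J + J
  offset = solve-∀ ℚ-ring
  node≡2j : node 0ℚ (2 ℕ.* i) m ≡ ℕ→ℚ (2 ℕ.* j)
  node≡2j = begin
    0ℚ + (ℕ→ℚ (2 ℕ.* i) - (ℕ→ℚ m + ℕ→ℚ m))
      ≡⟨ cong (λ R → 0ℚ + (R - (ℕ→ℚ m + ℕ→ℚ m))) (trans (ℕ→ℚ-2* i) (cong (λ I → I + I) ℕ→ℚ-i)) ⟩
    0ℚ + (((ℕ→ℚ m + ℕ→ℚ j) + (ℕ→ℚ m + ℕ→ℚ j)) - (ℕ→ℚ m + ℕ→ℚ m))
      ≡⟨ offset (ℕ→ℚ m) (ℕ→ℚ j) ⟩
    ℕ→ℚ j + ℕ→ℚ j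
      ≡⟨ ℕ→ℚ-2* j ⟨
    ℕ→ℚ (2 ℕ.* j) ∎
    where
    ℕ→ℚ-i : ℕ→ℚ i ≡ ℕ→ℚ m + ℕ→ℚ j
    ℕ→ℚ-i = trans (cong ℕ→ℚ (sym m+j≡i)) (ℕ→ℚ-+ m j)
  swap : ∀ b s v → b * (s * v) ≡ s * (b * v)
  swap = solve-∀ ℚ-ring

δ^2i-evenPow-at-0 : ∀ n i → 1 ≤ n → (δ ^[ 2 ℕ.* i ]) (evenPow n) 0ℚ ≡ two * sumRange 1 i (cTerm n i)
δ^2i-evenPow-at-0 n i 1≤n = begin
  (δ ^[ 2 ℕ.* i ]) (evenPow n) 0ℚ           ≡⟨ δ^r-expansion (2 ℕ.* i) (evenPow n) 0ℚ ⟩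
  ∑ (suc (2 ℕ.* i)) t                       ≡⟨ cong (λ r → ∑ r t) (halves i) ⟩
  ∑ (i ℕ.+ suc i) t                         ≡⟨ sumRange-++ 0 i (suc i) t ⟩
  ∑ i t + (t i + sumRange (suc i) i t)      ≡⟨ cong₂ (λ u v → ∑ i t + (u + v)) middle upper-half ⟩
  ∑ i t + (0ℚ + ∑ i t)                      ≡⟨ twice (∑ i t) ⟩
  two * ∑ i t                               ≡⟨ cong (two *_) lower-half ⟩
  two * sumRange 1 i (cTerm n i)            ∎
  where
  open ≡-Reasoning
  t : ℕ → ℚ
  t = stencil (evenPow n) 0ℚ (2 ℕ.* i)
  halves : ∀ i → suc (2 ℕ.* i) ≡ i ℕ.+ suc i
  halves = ℕ-Solver.solve-∀
  twice : ∀ a → a + (0ℚ + a) ≡ two * a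
  twice = solve-∀ ℚ-ring
  middle : t i ≡ 0ℚ
  middle = stencil-middle (evenPow n) (evenPow-0 n 1≤n) i
  -- the index reflected through i: m ↦ i + 1 + (i − 1 − m) = 2i − m
  reflect : ∀ {m} → m < i → m ℕ.+ (suc i ℕ.+ (i ∸ suc m)) ≡ 2 ℕ.* i
  reflect {m} m<i = begin
    m ℕ.+ (suc i ℕ.+ e)     ≡⟨ rearrange m i e ⟩
    i ℕ.+ (e ℕ.+ suc m)     ≡⟨ cong (i ℕ.+_) (NP.m∸n+n≡m m<i) ⟩
    i ℕ.+ i                 ≡⟨ doubling i ⟩
    2 ℕ.* i                 ∎
    where
    e = i ∸ suc m
    rearrange : ∀ m i e → m ℕ.+ (suc i ℕ.+ e) ≡ i ℕ.+ (e ℕ.+ suc m)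
    rearrange = ℕ-Solver.solve-∀
    doubling : ∀ i → i ℕ.+ i ≡ 2 ℕ.* i
    doubling = ℕ-Solver.solve-∀
  upper-half : sumRange (suc i) i t ≡ ∑ i t
  upper-half = begin
    sumRange (suc i) i t                        ≡⟨ sumRange-from-0 (suc i) i t ⟩
    ∑ i (λ m → t (suc i ℕ.+ m))                 ≡⟨ ∑-reverse i _ ⟩
    ∑ i (λ m → t (suc i ℕ.+ (i ∸ suc m)))       ≡⟨ ∑-cong i (λ m m<i →
                                                     stencil-symmetric (evenPow n) (evenPow-even n) i m _ (reflect m<i)) ⟩
    ∑ i t                                       ∎
  lower-half : ∑ i t ≡ sumRange 1 i (cTerm n i)
  lower-half = begin
    ∑ i t                                       ≡⟨ ∑-reverse i t ⟩
    ∑ i (λ m → t (i ∸ suc m))                   ≡⟨ ∑-cong i (λ m m<i → stencil-evenPow n i _ (suc m) (NP.m∸n+n≡m m<i)) ⟩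
    ∑ i (λ m → cTerm n i (suc m))               ≡⟨ sumRange-suc 0 i (cTerm n i) ⟨
    sumRange 1 i (cTerm n i)                    ∎

c-central-difference : ∀ n i → 1 ≤ n → c n i ≡ quarter ^ i * (δ ^[ 2 ℕ.* i ]) (evenPow n) 0ℚ
c-central-difference n i 1≤n = begin
  c n i                                       ≡⟨ cong (_* S) (two/four^ i) ⟩
  (two * quarter ^ i) * S                     ≡⟨ regroup (quarter ^ i) S ⟩
  quarter ^ i * (two * S)                     ≡⟨ cong (quarter ^ i *_) (δ^2i-evenPow-at-0 n i 1≤n) ⟨
  quarter ^ i * (δ ^[ 2 ℕ.* i ]) (evenPow n) 0ℚ ∎
  where
  open ≡-Reasoning
  S = sumRange 1 i (cTerm n i)
  regroup : ∀ q s → (two * q) * s ≡ q * (two * s)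
  regroup = solve-∀ ℚ-ring

-- c n i = 0 for i > n: δ^(2i) annihilates y^(2n).
c-vanishes-above : ∀ n i → 1 ≤ n → n < i → c n i ≡ 0ℚ
c-vanishes-above n i 1≤n n<i = begin
  c n i                                          ≡⟨ c-central-difference n i 1≤n ⟩
  quarter ^ i * (δ ^[ 2 ℕ.* i ]) (evenPow n) 0ℚ  ≡⟨ cong (quarter ^ i *_) (δ^r-kills-low-powers (2 ℕ.* n) (2 ℕ.* i) 0ℚ 2n<2i) ⟩
  quarter ^ i * 0ℚ                               ≡⟨ QP.*-zeroʳ (quarter ^ i) ⟩
  0ℚ                                             ∎
  where
  open ≡-Reasoning
  2n<2i : 2 ℕ.* n < 2 ℕ.* i
  2n<2i = NP.*-monoʳ-< 2 n<i

-- Σ_m C(k,m) ¼^(k+m) δ^(2k+2m) f = ¼^k μ^(2k) δ^(2k) f, by the binomial expansion of μ^(2k).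
∑-binomial-δ : ∀ k f x →
  ∑ (suc k) (λ m → ℕ→ℚ (k C m) * (quarter ^ (k ℕ.+ m) * (δ ^[ 2 ℕ.* (k ℕ.+ m) ]) f x))
    ≡ quarter ^ k * (μ ^[ 2 ℕ.* k ]) ((δ ^[ 2 ℕ.* k ]) f) x
∑-binomial-δ k f x = begin
  ∑ (suc k) (λ m → ℕ→ℚ (k C m) * (quarter ^ (k ℕ.+ m) * (δ ^[ 2 ℕ.* (k ℕ.+ m) ]) f x))
    ≡⟨ sumRange-cong 0 (suc k) factor ⟩
  ∑ (suc k) (λ m → quarter ^ k * (ℕ→ℚ (k C m) * (quarter ^ m * (δ ^[ 2 ℕ.* m ]) g x)))
    ≡⟨ sumRange-*ˡ 0 (suc k) (quarter ^ k) _ ⟩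
  quarter ^ k * ∑ (suc k) (λ m → ℕ→ℚ (k C m) * (quarter ^ m * (δ ^[ 2 ℕ.* m ]) g x))
    ≡⟨ cong (quarter ^ k *_) (μ^2k-binomial k g x) ⟨
  quarter ^ k * (μ ^[ 2 ℕ.* k ]) g x ∎
  where
  open ≡-Reasoning
  g = (δ ^[ 2 ℕ.* k ]) f
  rearrange : ∀ b u v w → b * ((u * v) * w) ≡ u * (b * (v * w))
  rearrange = solve-∀ ℚ-ring
  factor : ∀ m → ℕ→ℚ (k C m) * (quarter ^ (k ℕ.+ m) * (δ ^[ 2 ℕ.* (k ℕ.+ m) ]) f x)
               ≡ quarter ^ k * (ℕ→ℚ (k C m) * (quarter ^ m * (δ ^[ 2 ℕ.* m ]) g x))
  factor m = trans
    (cong₂ (λ u v → ℕ→ℚ (k C m) * (u * v)) (^-homo-* quarter k m)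
      (trans (cong (λ r → (δ ^[ r ]) f x) (NP.*-distribˡ-+ 2 k m)) (cong (λ h → h x) (^[]-+ δ (2 ℕ.* k) (2 ℕ.* m) f))))
    (rearrange (ℕ→ℚ (k C m)) (quarter ^ k) (quarter ^ m) _)

-- μ^r δ^r (y^(2n)) (0) = ½^r 4^n δ^r (y^(2n)) (0), via δ₂ at 0 = 0 + 0 and the dilation y ↦ 2y.
μ^rδ^r-evenPow : ∀ n r →
  (μ ^[ r ]) ((δ ^[ r ]) (evenPow n)) 0ℚ ≡ ½ ^ r * (four ^ n * (δ ^[ r ]) (evenPow n) 0ℚ)
μ^rδ^r-evenPow n r = begin
  (μ ^[ r ]) ((δ ^[ r ]) (evenPow n)) 0ℚ                ≡⟨ μ^rδ^r≡½^rδ₂^r r (evenPow n) 0ℚ ⟩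
  ½ ^ r * (δ₂ ^[ r ]) (evenPow n) (0ℚ + 0ℚ)             ≡⟨ cong (½ ^ r *_) (δ₂^r-dilation r (evenPow n) 0ℚ) ⟩
  ½ ^ r * (δ ^[ r ]) (λ y → evenPow n (y + y)) 0ℚ       ≡⟨ cong (½ ^ r *_) (^[]-ext δ-linear r (evenPow-dilate n) 0ℚ) ⟩
  ½ ^ r * (δ ^[ r ]) (λ y → four ^ n * evenPow n y) 0ℚ  ≡⟨ cong (½ ^ r *_) (scale (^[]-linear δ-linear r) (four ^ n) (evenPow n) 0ℚ) ⟩
  ½ ^ r * (four ^ n * (δ ^[ r ]) (evenPow n) 0ℚ)        ∎
  where open ≡-Reasoning

sumFromTo-as-∑ : ∀ a d h → sumFromTo a (a ℕ.+ d) h ≡ ∑ (suc d) (λ m → h (a ℕ.+ m))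
sumFromTo-as-∑ a d h = trans (cong (λ p → sumRange a p h) count) (sumRange-from-0 a (suc d) h)
  where
  count : suc (a ℕ.+ d) ∸ a ≡ suc d
  count = trans (cong (_∸ a) (sym (NP.+-suc a d))) (NP.m+n∸m≡n a (suc d))

-- In Σ_{m ≤ d} C(k,m) c (k+d) (k+m) only the terms with m ≤ min(k,d) survive, since
-- C(k,m) = 0 for m > k and c (k+d) (k+m) = 0 for m > d; so the sum may run up to k instead.
∑-up-to-k : ∀ k d → 1 ≤ k →
  ∑ (suc d) (λ m → ℕ→ℚ (k C m) * c (k ℕ.+ d) (k ℕ.+ m)) ≡ ∑ (suc k) (λ m → ℕ→ℚ (k C m) * c (k ℕ.+ d) (k ℕ.+ m))
∑-up-to-k k d 1≤k = drop-zeros (NP.≤-total k d)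
  where
  n = k ℕ.+ d
  G : ℕ → ℚ
  G m = ℕ→ℚ (k C m) * c n (k ℕ.+ m)
  G-beyond-k : ∀ m → suc k ≤ m → G m ≡ 0ℚ
  G-beyond-k m k<m = trans (cong (λ z → ℕ→ℚ z * c n (k ℕ.+ m)) (k>n⇒nCk≡0 k<m)) (QP.*-zeroˡ (c n (k ℕ.+ m)))
  G-beyond-d : ∀ m → suc d ≤ m → G m ≡ 0ℚ
  G-beyond-d m d<m = trans
    (cong (ℕ→ℚ (k C m) *_) (c-vanishes-above n (k ℕ.+ m) (NP.≤-trans 1≤k (NP.m≤m+n k d)) (NP.+-monoʳ-< k d<m)))
    (QP.*-zeroʳ (ℕ→ℚ (k C m)))
  drop-zeros : k ≤ d ⊎ d ≤ k → ∑ (suc d) G ≡ ∑ (suc k) G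
  drop-zeros (inj₁ k≤d) = ∑-drop-zeros (suc k) (suc d) G (s≤s k≤d) G-beyond-k
  drop-zeros (inj₂ d≤k) = sym (∑-drop-zeros (suc d) (suc k) G (s≤s d≤k) G-beyond-d)

quarter-four-cancel : ∀ k d v → quarter ^ k * (quarter ^ k * (four ^ (k ℕ.+ d) * v)) ≡ four ^ d * (quarter ^ k * v)
quarter-four-cancel k d v = begin
  quarter ^ k * (quarter ^ k * (four ^ (k ℕ.+ d) * v))
    ≡⟨ cong (λ z → quarter ^ k * (quarter ^ k * (z * v))) (^-homo-* four k d) ⟩
  quarter ^ k * (quarter ^ k * ((four ^ k * four ^ d) * v))
    ≡⟨ rearrange (quarter ^ k) (four ^ k) (four ^ d) v ⟩
  (four ^ k * quarter ^ k) * (four ^ d * (quarter ^ k * v))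
    ≡⟨ cong (_* (four ^ d * (quarter ^ k * v))) (four^*quarter^ k) ⟩
  1ℚ * (four ^ d * (quarter ^ k * v))
    ≡⟨ QP.*-identityˡ _ ⟩
  four ^ d * (quarter ^ k * v) ∎
  where
  open ≡-Reasoning
  rearrange : ∀ q a b v → q * (q * ((a * b) * v)) ≡ (a * q) * (b * (q * v))
  rearrange = solve-∀ ℚ-ring

lemma2p5-shifted : ∀ k d → 1 ≤ k →
  sumFromTo k (k ℕ.+ d) (λ i → ℕ→ℚ (k C (i ∸ k)) * c (k ℕ.+ d) i)
    ≡ ℕ→ℚ (2 ℕ.^ (2 ℕ.* d)) * c (k ℕ.+ d) k
lemma2p5-shifted k d 1≤k = begin
  sumFromTo k n (λ i → ℕ→ℚ (k C (i ∸ k)) * c n i)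
    ≡⟨ sumFromTo-as-∑ k d _ ⟩
  ∑ (suc d) (λ m → ℕ→ℚ (k C (k ℕ.+ m ∸ k)) * c n (k ℕ.+ m))
    ≡⟨ sumRange-cong 0 (suc d) (λ m → cong (λ z → ℕ→ℚ (k C z) * c n (k ℕ.+ m)) (NP.m+n∸m≡n k m)) ⟩
  ∑ (suc d) (λ m → ℕ→ℚ (k C m) * c n (k ℕ.+ m))
    ≡⟨ ∑-up-to-k k d 1≤k ⟩
  ∑ (suc k) (λ m → ℕ→ℚ (k C m) * c n (k ℕ.+ m))
    ≡⟨ sumRange-cong 0 (suc k) (λ m → cong (ℕ→ℚ (k C m) *_) (c-central-difference n (k ℕ.+ m) 1≤n)) ⟩
  ∑ (suc k) (λ m → ℕ→ℚ (k C m) * (quarter ^ (k ℕ.+ m) * (δ ^[ 2 ℕ.* (k ℕ.+ m) ]) p 0ℚ))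
    ≡⟨ ∑-binomial-δ k p 0ℚ ⟩
  quarter ^ k * (μ ^[ 2 ℕ.* k ]) ((δ ^[ 2 ℕ.* k ]) p) 0ℚ
    ≡⟨ cong (quarter ^ k *_) (μ^rδ^r-evenPow n (2 ℕ.* k)) ⟩
  quarter ^ k * (½ ^ (2 ℕ.* k) * (four ^ n * V))
    ≡⟨ cong (λ z → quarter ^ k * (z * (four ^ n * V))) (½^2*≡quarter^ k) ⟩
  quarter ^ k * (quarter ^ k * (four ^ n * V))
    ≡⟨ quarter-four-cancel k d V ⟩
  four ^ d * (quarter ^ k * V)
    ≡⟨ cong₂ _*_ (2^2*≡four^ d) (c-central-difference n k 1≤n) ⟨
  ℕ→ℚ (2 ℕ.^ (2 ℕ.* d)) * c n k ∎
  where
  open ≡-Reasoning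
  n = k ℕ.+ d
  p = evenPow n
  V = (δ ^[ 2 ℕ.* k ]) p 0ℚ
  1≤n : 1 ≤ n
  1≤n = NP.≤-trans 1≤k (NP.m≤m+n k d)

lemma2p5 : (n k : ℕ) → 1 ≤ k → k ≤ n →
    sumFromTo k n (λ i → ℕ→ℚ (k C (i ∸ k)) * c n i)
    ≡ ℕ→ℚ (2 ℕ.^ (2 ℕ.* (n ∸ k))) * c n k
lemma2p5 n k 1≤k k≤n =
  subst (λ N → sumFromTo k N (λ i → ℕ→ℚ (k C (i ∸ k)) * c N i) ≡ ℕ→ℚ (2 ℕ.^ (2 ℕ.* (n ∸ k))) * c N k)
        (NP.m+[n∸m]≡n k≤n)
        (lemma2p5-shifted k (n ∸ k) 1≤k)
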